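{- Let $p>2$ be a prime, let $K,k$ be positive integers, let $Y\subset\mathbb{Z}_p$ with $|Y|>1$, and set $X=KY^k-KY^k$. Then $$|(4K+1)Y^{k+1}-(4K+1)Y^{k+1}|\geq\frac{|X||Y|(p-1)}{|X||Y|+p-1}.$$
   Context: $\mathbb{Z}_p$ is the field of residues modulo $p$. $Y^m=\{y_1\cdots y_m:\ y_i\in Y\}$ is the $m$-fold product set, $mS=\{s_1+\dots+s_m:\ s_i\in S\}$ is the $m$-fold sumset, and $S-T=\{s-t:\ s\in S,t\in T\}$; thus $KY^k-KY^k=\{s-t:\ s,t\in K(Y^k)\}$. -}

module Defs where

open import Data.Nat using (ℕ; zero; suc; _+_; _*_; _∸_; NonZero)
open import Data.Nat.DivMod using (_mod_)
open import Data.Fin using (Fin; toℕ)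
open import Data.Fin.Properties using (_≟_)
open import Data.Fin.Subset using (Subset; _∈_; ∣_∣)
open import Data.Fin.Subset.Properties using (_∈?_)
open import Data.List using (List; []; _∷_; [_]; filter; concatMap; map; allFin)
open import Data.List.Relation.Unary.Any using (any?)
open import Data.Vec using (tabulate)
open import Relation.Nullary using (does)

module _ (p : ℕ) .{{_ : NonZero p}} where

  zeroₚ : Fin p
  zeroₚ = 0 mod p

  oneₚ : Fin p
  oneₚ = 1 mod p

  _+ₚ_ : Fin p → Fin p → Fin p
  x +ₚ y = (toℕ x + toℕ y) mod p

  _*ₚ_ : Fin p → Fin p → Fin p
  x *ₚ y = (toℕ x * toℕ y) mod p

  _-ₚ_ : Fin p → Fin p → Fin p
  x -ₚ y = (toℕ x + (p ∸ toℕ y)) mod p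

  elems : Subset p → List (Fin p)
  elems S = filter (_∈? S) (allFin p)

  fromList : List (Fin p) → Subset p
  fromList L = tabulate (λ x → does (any? (x ≟_) L))

  combine : (Fin p → Fin p → Fin p) → List (Fin p) → List (Fin p) → List (Fin p)
  combine f A B = concatMap (λ a → map (f a) B) A

  powSet : ℕ → Subset p → Subset p
  powSet zero    Y = fromList [ oneₚ ]
  powSet (suc m) Y = fromList (combine _*ₚ_ (elems Y) (elems (powSet m Y)))

  sumSet : ℕ → Subset p → Subset p
  sumSet zero    S = fromList [ zeroₚ ]
  sumSet (suc m) S = fromList (combine _+ₚ_ (elems S) (elems (sumSet m S)))

  diffSet : Subset p → Subset p → Subset p
  diffSet S T = fromList (combine _-ₚ_ (elems S) (elems T))

  KYk-KYk : ℕ → ℕ → Subset p → Subset p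
  KYk-KYk K k Y = diffSet (sumSet K (powSet k Y)) (sumSet K (powSet k Y))

{-# OPTIONS --safe #-}
-- Let N = |X||Y| and, for ξ in Z_p, let E(ξ) count the pairs of points (x, y), (x′, y′) of X × Y
-- with x + ξy = x′ + ξy′.  Two distinct lines meet at most once, so the sum of E(ξ) over ξ ≠ 0 is
-- at most N(p - 1) + N², and some ξ has (p - 1) E(ξ) ≤ N(p - 1) + N².  If ξ is a ratio
-- (a - b)/(c - d) with a, b ∈ X and c ≠ d in Y, then (x, y) ↦ (c - d)(x + ξy) maps X × Y into
-- Z = (4K+1)Y^{k+1} - (4K+1)Y^{k+1}, and Cauchy–Schwarz gives N² ≤ |Z| E(ξ).  Otherwise walk from
-- the ratio 0 to ξ in steps w ∈ Y^{k-1}, w ≠ 0: some ratio ξ′ has ξ′ + w not a ratio, and then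
-- (x, y) ↦ (c - d)(x + (ξ′ + w)y) is an injection of X × Y into Z, so N ≤ |Z|.  Either way
-- N(p - 1) ≤ |Z|(N + p - 1).
module Submission where

open import Defs
open import Data.Nat using (ℕ; zero; suc; NonZero; _∸_; _≤_; _<_; _≤?_; z≤n; s≤s; z<s; >-nonZero)
import Data.Nat as ℕ
import Data.Nat.Properties as ℕ
import Data.Nat.Divisibility as ℕ
open import Data.Nat.DivMod using (_%_; _/_; _mod_; m≡m%n+[m/n]*n; m%n<n; m<n⇒m%n≡m)
open import Data.Nat.Coprimality using (prime⇒coprime; coprime-Bézout)
open import Data.Nat.GCD using (module Bézout)
open import Data.Nat.Primality using (Prime; prime⇒nonZero; prime⇒nonTrivial; euclidsLemma)
open import Data.Integer as ℤ using (ℤ)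
import Data.Integer.Properties as ℤ
open import Data.Integer.Divisibility.Signed
  using (divides; ∣⇒∣ᵤ; ∣m∣n⇒∣m+n; ∣m∣n⇒∣m-n; ∣n⇒∣m*n; ∣m⇒∣m*n; ∣m⇒∣-m)
  renaming (_∣_ to _∣ℤ_)
open import Data.Fin as Fin using (Fin; toℕ; fromℕ<; remQuot)
open import Data.Fin.Properties using (_≟_; toℕ-fromℕ<; toℕ-injective; toℕ<n; combine-remQuot)
import Data.Fin.Properties as Fin
open import Data.Fin.Subset using (Subset; _∈_; ∣_∣; inside; outside; ∁; ⁅_⁆)
open import Data.Fin.Subset.Properties using (_∈?_; ∣∁p∣≡n∸∣p∣; ∣⁅x⁆∣≡1)
open import Data.List as List using (List; []; _∷_; _++_; cartesianProductWith)
import Data.List.Relation.Unary.Any as Any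
open import Data.List.Membership.Propositional using () renaming (_∈_ to _∈ₗ_)
open import Data.List.Membership.Propositional.Properties
  using (∈-filter⁺; ∈-filter⁻; ∈-allFin; ∈-cartesianProductWith⁺; ∈-cartesianProductWith⁻)
open import Data.Vec using (Vec; []; _∷_; here; there; lookup; map)
open import Data.Vec.Properties using (lookup⇒[]=; []=⇒lookup; lookup∘tabulate; lookup-map)
open import Data.Vec.N-ary using (N-ary; Eq; Eqʰ; curryⁿ; curryⁿ-cong; curryⁿ-cong⁻¹)
open import Data.Bool using (if_then_else_)
open import Data.Empty using (⊥-elim)
open import Data.Product using (∃-syntax; ∃₂; _×_; _,_; proj₁; proj₂; uncurry)
open import Data.Sum as Sum using (_⊎_; [_,_]′)
open import Function using (_⇔_; mk⇔; Injective; module Equivalence)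
open import Relation.Nullary using (Dec; does; yes; no; ¬_; contradiction)
open import Relation.Nullary.Decidable using (dec-true; _×-dec_; ¬?)
open import Relation.Unary using (Decidable)
open import Relation.Binary.PropositionalEquality
open import Tactic.RingSolver.Core.Expression using (Expr; Κ; Ι; _⊕_; _⊗_; _⊛_; ⊝_)

-- Arithmetic modulo p

module Residues (p : ℕ) .{{_ : NonZero p}} where

  open import Data.Integer using (+_; -[1+_]; _+_; _-_; _*_; -_)
  open import Data.Integer.Tactic.RingSolver using (solve-∀; ring)
  open import Tactic.RingSolver.NonReflective ring using (solve; module Ops)
  open Ops using (⟦_⟧; ⟦_⇓⟧; close)

  infixl 6 _⊞_ _⊟_
  infixl 7 _⊠_

  _⊞_ _⊟_ _⊠_ : Fin p → Fin p → Fin p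
  _⊞_ = _+ₚ_ p
  _⊟_ = _-ₚ_ p
  _⊠_ = _*ₚ_ p

  𝟎 𝟏 : Fin p
  𝟎 = zeroₚ p
  𝟏 = oneₚ p

  infix 4 _≈_
  record _≈_ (a b : ℤ) : Set where
    constructor mk≈
    field p∣a-b : + p ∣ℤ (a - b)

  ≈-by-multiple : ∀ {a b} q → a - b ≡ q * + p → a ≈ b
  ≈-by-multiple q eq = mk≈ (divides q eq)

  private
    p∣-resp : ∀ {a b} → a ≡ b → + p ∣ℤ a → + p ∣ℤ b
    p∣-resp refl p∣a = p∣a

  ≈-reflexive : ∀ {a b} → a ≡ b → a ≈ b
  ≈-reflexive {a} refl = ≈-by-multiple (+ 0) (ℤ.+-inverseʳ a)

  ≈-sym : ∀ {a b} → a ≈ b → b ≈ a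
  ≈-sym {a} {b} (mk≈ p∣a-b) = mk≈ (p∣-resp (lemma a b) (∣m⇒∣-m p∣a-b))
    where
    lemma : ∀ a b → - (a - b) ≡ b - a
    lemma = solve-∀

  ≈-trans : ∀ {a b c} → a ≈ b → b ≈ c → a ≈ c
  ≈-trans {a} {b} {c} (mk≈ p∣a-b) (mk≈ p∣b-c) =
    mk≈ (p∣-resp (lemma a b c) (∣m∣n⇒∣m+n p∣a-b p∣b-c))
    where
    lemma : ∀ a b c → (a - b) + (b - c) ≡ a - c
    lemma = solve-∀

  +-cong : ∀ {a b c d} → a ≈ b → c ≈ d → a + c ≈ b + d
  +-cong {a} {b} {c} {d} (mk≈ p∣a-b) (mk≈ p∣c-d) =
    mk≈ (p∣-resp (lemma a b c d) (∣m∣n⇒∣m+n p∣a-b p∣c-d))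
    where
    lemma : ∀ a b c d → (a - b) + (c - d) ≡ (a + c) - (b + d)
    lemma = solve-∀

  -‿cong : ∀ {a b c d} → a ≈ b → c ≈ d → a - c ≈ b - d
  -‿cong {a} {b} {c} {d} (mk≈ p∣a-b) (mk≈ p∣c-d) =
    mk≈ (p∣-resp (lemma a b c d) (∣m∣n⇒∣m-n p∣a-b p∣c-d))
    where
    lemma : ∀ a b c d → (a - b) - (c - d) ≡ (a - c) - (b - d)
    lemma = solve-∀

  *-cong : ∀ {a b c d} → a ≈ b → c ≈ d → a * c ≈ b * d
  *-cong {a} {b} {c} {d} (mk≈ p∣a-b) (mk≈ p∣c-d) =
    mk≈ (p∣-resp (lemma a b c d) (∣m∣n⇒∣m+n (∣m⇒∣m*n c p∣a-b) (∣n⇒∣m*n b p∣c-d)))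
    where
    lemma : ∀ a b c d → (a - b) * c + b * (c - d) ≡ a * c - b * d
    lemma = solve-∀

  ⟦_⟧ℤ : Fin p → ℤ
  ⟦ x ⟧ℤ = + toℕ x

  ⟦mod⟧ : ∀ n → ⟦ n mod p ⟧ℤ ≈ + n
  ⟦mod⟧ n = ≈-by-multiple (- + (n / p)) (begin
    ⟦ n mod p ⟧ℤ - + n
      ≡⟨ cong₂ (λ r m → + r - + m) (toℕ-fromℕ< (m%n<n n p)) (m≡m%n+[m/n]*n n p) ⟩
    + (n % p) - + (n % p ℕ.+ n / p ℕ.* p)
      ≡⟨ cong (λ m → + (n % p) - m) (trans (ℤ.pos-+ (n % p) _) (cong (λ m → + (n % p) + m) (ℤ.pos-* (n / p) p))) ⟩
    + (n % p) - (+ (n % p) + + (n / p) * + p)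
      ≡⟨ lemma (+ (n % p)) (+ (n / p)) (+ p) ⟩
    - + (n / p) * + p
      ∎)
    where
    open ≡-Reasoning
    lemma : ∀ r q p → r - (r + q * p) ≡ - q * p
    lemma = solve-∀

  ⟦⊞⟧ : ∀ x y → ⟦ x ⊞ y ⟧ℤ ≈ ⟦ x ⟧ℤ + ⟦ y ⟧ℤ
  ⟦⊞⟧ x y = ≈-trans (⟦mod⟧ _) (≈-reflexive (ℤ.pos-+ (toℕ x) (toℕ y)))

  ⟦⊠⟧ : ∀ x y → ⟦ x ⊠ y ⟧ℤ ≈ ⟦ x ⟧ℤ * ⟦ y ⟧ℤ
  ⟦⊠⟧ x y = ≈-trans (⟦mod⟧ _) (≈-reflexive (ℤ.pos-* (toℕ x) (toℕ y)))

  ⟦⊟⟧ : ∀ x y → ⟦ x ⊟ y ⟧ℤ ≈ ⟦ x ⟧ℤ - ⟦ y ⟧ℤ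
  ⟦⊟⟧ x y = ≈-trans (⟦mod⟧ _) (≈-by-multiple (+ 1) (begin
    + (toℕ x ℕ.+ (p ∸ toℕ y)) - (⟦ x ⟧ℤ - ⟦ y ⟧ℤ)
      ≡⟨ cong (_- (⟦ x ⟧ℤ - ⟦ y ⟧ℤ)) (trans (ℤ.pos-+ (toℕ x) (p ∸ toℕ y)) (cong (λ m → ⟦ x ⟧ℤ + m) p-y)) ⟩
    ⟦ x ⟧ℤ + (+ p - ⟦ y ⟧ℤ) - (⟦ x ⟧ℤ - ⟦ y ⟧ℤ)
      ≡⟨ lemma ⟦ x ⟧ℤ ⟦ y ⟧ℤ (+ p) ⟩
    + 1 * + p
      ∎))
    where
    open ≡-Reasoning
    p-y : + (p ∸ toℕ y) ≡ + p - ⟦ y ⟧ℤ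
    p-y = sym (trans (ℤ.m-n≡m⊖n p (toℕ y)) (ℤ.⊖-≥ (ℕ.<⇒≤ (toℕ<n y))))
    lemma : ∀ x y p → x + (p - y) - (x - y) ≡ + 1 * p
    lemma = solve-∀

  ≈⇒≡ : ∀ {x y} → ⟦ x ⟧ℤ ≈ ⟦ y ⟧ℤ → x ≡ y
  ≈⇒≡ {x} {y} (mk≈ p∣x-y) =
    toℕ-injective (ℤ.+-injective (ℤ.i-j≡0⇒i≡j _ _ (ℤ.∣i∣≡0⇒i≡0 ∣x-y∣≡0)))
    where
    ∣x-y∣<p : ℤ.∣ ⟦ x ⟧ℤ - ⟦ y ⟧ℤ ∣ < p
    ∣x-y∣<p = ℕ.≤-<-trans (ℕ.≤-reflexive (cong ℤ.∣_∣ (ℤ.m-n≡m⊖n (toℕ x) (toℕ y))))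
                (ℕ.≤-<-trans (ℤ.∣m⊝n∣≤m⊔n (toℕ x) (toℕ y)) (ℕ.⊔-lub (toℕ<n x) (toℕ<n y)))
    ∣x-y∣≡0 : ℤ.∣ ⟦ x ⟧ℤ - ⟦ y ⟧ℤ ∣ ≡ 0
    ∣x-y∣≡0 = trans (sym (m<n⇒m%n≡m ∣x-y∣<p)) (ℕ.n∣m⇒m%n≡0 _ p (∣⇒∣ᵤ p∣x-y))

  fromℤ : ℤ → Fin p
  fromℤ (+ n)    = n mod p
  fromℤ -[1+ n ] = 𝟎 ⊟ suc n mod p

  ⟦fromℤ⟧ : ∀ c → ⟦ fromℤ c ⟧ℤ ≈ c
  ⟦fromℤ⟧ (+ n)    = ⟦mod⟧ n
  ⟦fromℤ⟧ -[1+ n ] = ≈-trans (⟦⊟⟧ 𝟎 (suc n mod p)) (-‿cong (⟦mod⟧ 0) (⟦mod⟧ (suc n)))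

  _^ₚ_ : Fin p → ℕ → Fin p
  x ^ₚ 0           = 𝟏
  x ^ₚ 1           = x
  x ^ₚ suc (suc k) = x ^ₚ suc k ⊠ x

  -- Reduction mod p carries ring identities over ℤ to Z_p (evalₚ-sound).  e ⊕ ⊝ e′ is evaluated as
  -- e ⊟ e′ so that the identities proved by solveₚ are stated with the subtraction of Defs.
  evalₚ : ∀ {n} → Expr ℤ n → Vec (Fin p) n → Fin p
  evalₚ (e ⊕ (⊝ e′)) ρ = evalₚ e ρ ⊟ evalₚ e′ ρ
  evalₚ (e ⊕ e′)     ρ = evalₚ e ρ ⊞ evalₚ e′ ρ
  evalₚ (e ⊗ e′)     ρ = evalₚ e ρ ⊠ evalₚ e′ ρ
  evalₚ (Κ c)        ρ = fromℤ c
  evalₚ (Ι i)        ρ = lookup ρ i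
  evalₚ (e ⊛ k)      ρ = evalₚ e ρ ^ₚ k
  evalₚ (⊝ e)        ρ = 𝟎 ⊟ evalₚ e ρ

  evalₚ-sound : ∀ {n} (e : Expr ℤ n) ρ → ⟦ evalₚ e ρ ⟧ℤ ≈ ⟦ e ⟧ (map ⟦_⟧ℤ ρ)
  ⊞-sound : ∀ {n} (e e′ : Expr ℤ n) ρ →
            ⟦ evalₚ e ρ ⊞ evalₚ e′ ρ ⟧ℤ ≈ ⟦ e ⊕ e′ ⟧ (map ⟦_⟧ℤ ρ)

  evalₚ-sound (e ⊕ (⊝ e′))    ρ =
    ≈-trans (⟦⊟⟧ (evalₚ e ρ) (evalₚ e′ ρ)) (-‿cong (evalₚ-sound e ρ) (evalₚ-sound e′ ρ))
  evalₚ-sound (e ⊕ Κ c)       ρ = ⊞-sound e (Κ c) ρ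
  evalₚ-sound (e ⊕ Ι i)       ρ = ⊞-sound e (Ι i) ρ
  evalₚ-sound (e ⊕ (e′ ⊕ e″)) ρ = ⊞-sound e (e′ ⊕ e″) ρ
  evalₚ-sound (e ⊕ (e′ ⊗ e″)) ρ = ⊞-sound e (e′ ⊗ e″) ρ
  evalₚ-sound (e ⊕ (e′ ⊛ k))  ρ = ⊞-sound e (e′ ⊛ k) ρ
  evalₚ-sound (e ⊗ e′)        ρ =
    ≈-trans (⟦⊠⟧ (evalₚ e ρ) (evalₚ e′ ρ)) (*-cong (evalₚ-sound e ρ) (evalₚ-sound e′ ρ))
  evalₚ-sound (Κ c)           ρ = ⟦fromℤ⟧ c
  evalₚ-sound (Ι i)           ρ = ≈-reflexive (sym (lookup-map i ⟦_⟧ℤ ρ))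
  evalₚ-sound (e ⊛ k)         ρ = power k
    where
    power : ∀ k → ⟦ evalₚ e ρ ^ₚ k ⟧ℤ ≈ ⟦ e ⊛ k ⟧ (map ⟦_⟧ℤ ρ)
    power 0             = ⟦mod⟧ 1
    power 1             = evalₚ-sound e ρ
    power (suc (suc k)) =
      ≈-trans (⟦⊠⟧ (evalₚ e ρ ^ₚ suc k) (evalₚ e ρ)) (*-cong (power (suc k)) (evalₚ-sound e ρ))
  evalₚ-sound (⊝ e)           ρ =
    ≈-trans (⟦⊟⟧ 𝟎 (evalₚ e ρ))
      (≈-trans (-‿cong (⟦mod⟧ 0) (evalₚ-sound e ρ)) (≈-reflexive (ℤ.+-identityˡ _)))

  ⊞-sound e e′ ρ =
    ≈-trans (⟦⊞⟧ (evalₚ e ρ) (evalₚ e′ ρ)) (+-cong (evalₚ-sound e ρ) (evalₚ-sound e′ ρ))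

  transfer≈ : ∀ {n} (e₁ e₂ : Expr ℤ n) ρ →
              ⟦ e₁ ⟧ (map ⟦_⟧ℤ ρ) ≈ ⟦ e₂ ⟧ (map ⟦_⟧ℤ ρ) → evalₚ e₁ ρ ≡ evalₚ e₂ ρ
  transfer≈ e₁ e₂ ρ e₁≈e₂ =
    ≈⇒≡ (≈-trans (evalₚ-sound e₁ ρ) (≈-trans e₁≈e₂ (≈-sym (evalₚ-sound e₂ ρ))))

  infixl 6 _⊖_
  _⊖_ : ∀ {n} → Expr ℤ n → Expr ℤ n → Expr ℤ n
  e ⊖ e′ = e ⊕ ⊝ e′

  infix 4 _:=_
  _:=_ : ∀ {n} → Expr ℤ n → Expr ℤ n → Expr ℤ n × Expr ℤ n
  _:=_ = _,_

  solveₚ : ∀ n (f : N-ary n (Expr ℤ n) (Expr ℤ n × Expr ℤ n)) →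
           Eqʰ n _≡_ (curryⁿ ⟦ proj₁ (close n f) ⇓⟧) (curryⁿ ⟦ proj₂ (close n f) ⇓⟧) →
           Eq n _≡_ (curryⁿ (evalₚ (proj₁ (close n f)))) (curryⁿ (evalₚ (proj₂ (close n f))))
  solveₚ n f hyp = curryⁿ-cong _≡_ (evalₚ (proj₁ (close n f))) (evalₚ (proj₂ (close n f))) (λ ρ →
    transfer≈ (proj₁ (close n f)) (proj₂ (close n f)) ρ (≈-reflexive
      (curryⁿ-cong⁻¹ _≡_ ⟦ proj₁ (close n f) ⟧ ⟦ proj₂ (close n f) ⟧ (solve n f hyp) (map ⟦_⟧ℤ ρ))))

  ⊞-identityˡ : ∀ x → 𝟎 ⊞ x ≡ x
  ⊞-identityˡ = solveₚ 1 (λ x → Κ (+ 0) ⊕ x := x) refl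

  ⊞-assoc : ∀ x y z → x ⊞ y ⊞ z ≡ x ⊞ (y ⊞ z)
  ⊞-assoc = solveₚ 3 (λ x y z → x ⊕ y ⊕ z := x ⊕ (y ⊕ z)) refl

  ⊠-zeroʳ : ∀ x → x ⊠ 𝟎 ≡ 𝟎
  ⊠-zeroʳ = solveₚ 1 (λ x → x ⊗ Κ (+ 0) := Κ (+ 0)) refl

  ⊠-distribˡ-⊞ : ∀ x y z → x ⊠ (y ⊞ z) ≡ x ⊠ y ⊞ x ⊠ z
  ⊠-distribˡ-⊞ = solveₚ 3 (λ x y z → x ⊗ (y ⊕ z) := x ⊗ y ⊕ x ⊗ z) refl

  ⊠-distribˡ-⊟ : ∀ x y z → x ⊠ (y ⊟ z) ≡ x ⊠ y ⊟ x ⊠ z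
  ⊠-distribˡ-⊟ = solveₚ 3 (λ x y z → x ⊗ (y ⊖ z) := x ⊗ y ⊖ x ⊗ z) refl

  x⊟x≡𝟎 : ∀ x → x ⊟ x ≡ 𝟎
  x⊟x≡𝟎 = solveₚ 1 (λ x → x ⊖ x := Κ (+ 0)) refl

  ≡⇒⊟≡𝟎 : ∀ {x y} → x ≡ y → x ⊟ y ≡ 𝟎
  ≡⇒⊟≡𝟎 {x} refl = x⊟x≡𝟎 x

  ⊟≡𝟎⇒≡ : ∀ {x y} → x ⊟ y ≡ 𝟎 → x ≡ y
  ⊟≡𝟎⇒≡ {x} {y} x-y≡𝟎 = begin
    x            ≡⟨ solveₚ 2 (λ x y → x := x ⊖ y ⊕ y) refl x y ⟩
    x ⊟ y ⊞ y    ≡⟨ cong (_⊞ y) x-y≡𝟎 ⟩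
    𝟎 ⊞ y        ≡⟨ ⊞-identityˡ y ⟩
    y            ∎
    where open ≡-Reasoning

  ⊞-cancelʳ : ∀ {x y} z → x ⊞ z ≡ y ⊞ z → x ≡ y
  ⊞-cancelʳ {x} {y} z eq = ⊟≡𝟎⇒≡ (begin
    x ⊟ y                ≡⟨ solveₚ 3 (λ x y z → x ⊖ y := x ⊕ z ⊖ (y ⊕ z)) refl x y z ⟩
    (x ⊞ z) ⊟ (y ⊞ z)    ≡⟨ ≡⇒⊟≡𝟎 eq ⟩
    𝟎                    ∎)
    where open ≡-Reasoning

  slope : ∀ {x y x′ y′ ζ} → x ⊞ ζ ⊠ y ≡ x′ ⊞ ζ ⊠ y′ → ζ ⊠ (y′ ⊟ y) ≡ x ⊟ x′
  slope {x} {y} {x′} {y′} {ζ} meet = begin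
    ζ ⊠ (y′ ⊟ y)
      ≡⟨ solveₚ 5 (λ x y x′ y′ ζ → ζ ⊗ (y′ ⊖ y) := x′ ⊕ ζ ⊗ y′ ⊖ (x ⊕ ζ ⊗ y) ⊕ (x ⊖ x′)) refl x y x′ y′ ζ ⟩
    x′ ⊞ ζ ⊠ y′ ⊟ (x ⊞ ζ ⊠ y) ⊞ (x ⊟ x′)
      ≡⟨ cong (_⊞ (x ⊟ x′)) (≡⇒⊟≡𝟎 (sym meet)) ⟩
    𝟎 ⊞ (x ⊟ x′)
      ≡⟨ ⊞-identityˡ (x ⊟ x′) ⟩
    x ⊟ x′
      ∎
    where open ≡-Reasoning

  ∈-fromList⁺ : ∀ {x L} → x ∈ₗ L → x ∈ fromList p L
  ∈-fromList⁺ {x} {L} x∈L =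
    lookup⇒[]= x (fromList p L) (trans (lookup∘tabulate _ x) (dec-true (Any.any? (x ≟_) L) x∈L))

  ∈-fromList⁻ : ∀ {x L} → x ∈ fromList p L → x ∈ₗ L
  ∈-fromList⁻ {x} {L} x∈L with Any.any? (x ≟_) L in eq
  ... | yes x∈ₗL = x∈ₗL
  ... | no _ with () ← trans (sym (cong does eq)) (trans (sym (lookup∘tabulate _ x)) ([]=⇒lookup x∈L))

  ∈-elems⁺ : ∀ {x S} → x ∈ S → x ∈ₗ elems p S
  ∈-elems⁺ {x} {S} x∈S = ∈-filter⁺ (_∈? S) (∈-allFin x) x∈S

  ∈-elems⁻ : ∀ {x S} → x ∈ₗ elems p S → x ∈ S
  ∈-elems⁻ {S = S} x∈S = proj₂ (∈-filter⁻ (_∈? S) {xs = List.allFin p} x∈S)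

  combine≡cartesianProductWith : ∀ f (A B : List (Fin p)) → combine p f A B ≡ cartesianProductWith f A B
  combine≡cartesianProductWith f []      B = refl
  combine≡cartesianProductWith f (a ∷ A) B = cong (List.map (f a) B ++_) (combine≡cartesianProductWith f A B)

  ∈-combine⁺ : ∀ f {S T a b} → a ∈ S → b ∈ T →
               f a b ∈ fromList p (combine p f (elems p S) (elems p T))
  ∈-combine⁺ f {S} {T} {a} {b} a∈S b∈T =
    ∈-fromList⁺ (subst (f a b ∈ₗ_) (sym (combine≡cartesianProductWith f (elems p S) (elems p T)))
      (∈-cartesianProductWith⁺ f (∈-elems⁺ a∈S) (∈-elems⁺ b∈T)))

  ∈-combine⁻ : ∀ f {S T t} → t ∈ fromList p (combine p f (elems p S) (elems p T)) →
               ∃₂ λ a b → a ∈ S × b ∈ T × t ≡ f a b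
  ∈-combine⁻ f {S} {T} {t} t∈
    with a , b , a∈ , b∈ , t≡ ← ∈-cartesianProductWith⁻ f (elems p S) (elems p T)
           (subst (t ∈ₗ_) (combine≡cartesianProductWith f (elems p S) (elems p T)) (∈-fromList⁻ t∈))
    = a , b , ∈-elems⁻ a∈ , ∈-elems⁻ b∈ , t≡

  ∈-singleton⁻ : ∀ {x y} → x ∈ fromList p (y ∷ []) → x ≡ y
  ∈-singleton⁻ {y = y} x∈ with Any.here x≡y ← ∈-fromList⁻ {L = y ∷ []} x∈ = x≡y

  𝟏∈powSet-zero : ∀ {Y} → 𝟏 ∈ powSet p 0 Y
  𝟏∈powSet-zero = ∈-fromList⁺ {L = 𝟏 ∷ []} (Any.here refl)

  ∈-powSet-suc⁺ : ∀ {m Y y w} → y ∈ Y → w ∈ powSet p m Y → y ⊠ w ∈ powSet p (suc m) Y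
  ∈-powSet-suc⁺ {m} {Y} = ∈-combine⁺ _⊠_ {Y} {powSet p m Y}

  𝟎∈sumSet-zero : ∀ {S} → 𝟎 ∈ sumSet p 0 S
  𝟎∈sumSet-zero = ∈-fromList⁺ {L = 𝟎 ∷ []} (Any.here refl)

  ∈-sumSet-suc⁺ : ∀ {m S a s} → a ∈ S → s ∈ sumSet p m S → a ⊞ s ∈ sumSet p (suc m) S
  ∈-sumSet-suc⁺ {m} {S} = ∈-combine⁺ _⊞_ {S} {sumSet p m S}

  ∈-sumSet-suc⁻ : ∀ {m S t} → t ∈ sumSet p (suc m) S →
                  ∃₂ λ a s → a ∈ S × s ∈ sumSet p m S × t ≡ a ⊞ s
  ∈-sumSet-suc⁻ {m} {S} = ∈-combine⁻ _⊞_ {S} {sumSet p m S}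

  ∈-diffSet⁺ : ∀ {S T a b} → a ∈ S → b ∈ T → a ⊟ b ∈ diffSet p S T
  ∈-diffSet⁺ {S} {T} = ∈-combine⁺ _⊟_ {S} {T}

  ∈-diffSet⁻ : ∀ {S T t} → t ∈ diffSet p S T → ∃₂ λ a b → a ∈ S × b ∈ T × t ≡ a ⊟ b
  ∈-diffSet⁻ {S} {T} = ∈-combine⁻ _⊟_ {S} {T}

  ∈-sumSet-+ : ∀ m n {S s s′} → s ∈ sumSet p m S → s′ ∈ sumSet p n S →
               s ⊞ s′ ∈ sumSet p (m ℕ.+ n) S
  ∈-sumSet-+ zero    n {S} {s′ = s′} s∈ s′∈ rewrite ∈-singleton⁻ s∈ =
    subst (_∈ sumSet p n S) (sym (⊞-identityˡ s′)) s′∈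
  ∈-sumSet-+ (suc m) n {S} {s′ = s′} s∈ s′∈
    with a , s , a∈ , s∈′ , refl ← ∈-sumSet-suc⁻ {m} {S} s∈ =
    subst (_∈ sumSet p (suc m ℕ.+ n) S) (sym (⊞-assoc a s s′))
      (∈-sumSet-suc⁺ {m ℕ.+ n} {S} a∈ (∈-sumSet-+ m n s∈′ s′∈))

  ∈-sumSet-scale : ∀ m {S T c u} → (∀ {s} → s ∈ S → c ⊠ s ∈ T) →
                   u ∈ sumSet p m S → c ⊠ u ∈ sumSet p m T
  ∈-sumSet-scale zero    {T = T} {c} cS⊆T u∈ rewrite ∈-singleton⁻ u∈ =
    subst (_∈ sumSet p 0 T) (sym (⊠-zeroʳ c)) (𝟎∈sumSet-zero {T})
  ∈-sumSet-scale (suc m) {S} {T} {c} cS⊆T u∈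
    with a , s , a∈ , s∈ , refl ← ∈-sumSet-suc⁻ {m} {S} u∈ =
    subst (_∈ sumSet p (suc m) T) (sym (⊠-distribˡ-⊞ c a s))
      (∈-sumSet-suc⁺ {m} {T} (cS⊆T a∈) (∈-sumSet-scale m {S} {T} {c} cS⊆T s∈))

  ∃-sumSet : ∀ {S s} → s ∈ S → ∀ m → ∃[ t ] t ∈ sumSet p m S
  ∃-sumSet {S} s∈S zero    = 𝟎 , 𝟎∈sumSet-zero {S}
  ∃-sumSet {S} s∈S (suc m) with t , t∈ ← ∃-sumSet s∈S m = _ , ∈-sumSet-suc⁺ {m} {S} s∈S t∈

module PrimeField (p : ℕ) (pr : Prime p) where

  instance
    p-nonZero : NonZero p
    p-nonZero = prime⇒nonZero pr

  open Residues p public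
  open import Data.Integer using (+_; _+_; _-_; _*_; -_)
  open import Data.Integer.Tactic.RingSolver using (solve-∀)

  1<p : 1 < p
  1<p = ℕ.nonTrivial⇒n>1 p {{prime⇒nonTrivial pr}}

  toℕ-𝟎 : toℕ 𝟎 ≡ 0
  toℕ-𝟎 = trans (toℕ-fromℕ< (m%n<n 0 p)) (m<n⇒m%n≡m (ℕ.<-trans z<s 1<p))

  p∣toℕ⇒≡𝟎 : ∀ {x} → p ℕ.∣ toℕ x → x ≡ 𝟎
  p∣toℕ⇒≡𝟎 {x} p∣x =
    toℕ-injective (trans (sym (m<n⇒m%n≡m (toℕ<n x))) (trans (ℕ.n∣m⇒m%n≡0 _ p p∣x) (sym toℕ-𝟎)))

  𝟏≢𝟎 : 𝟏 ≢ 𝟎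
  𝟏≢𝟎 𝟏≡𝟎 = ℕ.1+n≢0 (trans (sym toℕ-𝟏) (trans (cong toℕ 𝟏≡𝟎) toℕ-𝟎))
    where
    toℕ-𝟏 : toℕ 𝟏 ≡ 1
    toℕ-𝟏 = trans (toℕ-fromℕ< (m%n<n 1 p)) (m<n⇒m%n≡m 1<p)

  ⊠-integral : ∀ {x y} → x ⊠ y ≡ 𝟎 → x ≡ 𝟎 ⊎ y ≡ 𝟎
  ⊠-integral {x} {y} xy≡𝟎 = Sum.map p∣toℕ⇒≡𝟎 p∣toℕ⇒≡𝟎 (euclidsLemma (toℕ x) (toℕ y) pr p∣xy)
    where
    p∣xy : p ℕ.∣ toℕ x ℕ.* toℕ y
    p∣xy = ℕ.m%n≡0⇒n∣m _ p (trans (sym (toℕ-fromℕ< (m%n<n _ p))) (trans (cong toℕ xy≡𝟎) toℕ-𝟎))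

  ⊠-≢𝟎 : ∀ {x y} → x ≢ 𝟎 → y ≢ 𝟎 → x ⊠ y ≢ 𝟎
  ⊠-≢𝟎 x≢𝟎 y≢𝟎 xy≡𝟎 = Sum.[ x≢𝟎 , y≢𝟎 ] (⊠-integral xy≡𝟎)

  ⊟-≢𝟎 : ∀ {x y} → x ≢ y → x ⊟ y ≢ 𝟎
  ⊟-≢𝟎 x≢y x-y≡𝟎 = x≢y (⊟≡𝟎⇒≡ x-y≡𝟎)

  ⊠-cancelˡ : ∀ {c x y} → c ≢ 𝟎 → c ⊠ x ≡ c ⊠ y → x ≡ y
  ⊠-cancelˡ {c} {x} {y} c≢𝟎 eq = Sum.[ (λ c≡𝟎 → contradiction c≡𝟎 c≢𝟎) , ⊟≡𝟎⇒≡ ] (⊠-integral (begin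
    c ⊠ (x ⊟ y)      ≡⟨ ⊠-distribˡ-⊟ c x y ⟩
    c ⊠ x ⊟ c ⊠ y    ≡⟨ ≡⇒⊟≡𝟎 eq ⟩
    𝟎                ∎))
    where open ≡-Reasoning

  ⊠-inverse : ∀ {x} → x ≢ 𝟎 → ∃[ μ ] x ⊠ μ ≡ 𝟏
  ⊠-inverse {x} x≢𝟎 with coprime-Bézout (prime⇒coprime pr {{n≢0}} (toℕ<n x))
    where
    n≢0 : NonZero (toℕ x)
    n≢0 = ℕ.≢-nonZero (λ n≡0 → x≢𝟎 (toℕ-injective (trans n≡0 (sym toℕ-𝟎))))
  ... | Bézout.-+ a b 1+ap≡bn = b mod p ,
    transfer≈ (Ι Fin.zero ⊗ Κ (+ b)) (Κ (+ 1)) (x ∷ []) (≈-by-multiple (+ a) (begin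
      ⟦ x ⟧ℤ * + b - + 1         ≡⟨ cong (_- + 1) (trans (sym (ℤ.pos-* (toℕ x) b)) (cong +_ (ℕ.*-comm (toℕ x) b))) ⟩
      + (b ℕ.* toℕ x) - + 1      ≡⟨ cong (λ m → + m - + 1) (sym 1+ap≡bn) ⟩
      + (1 ℕ.+ a ℕ.* p) - + 1    ≡⟨ cong (_- + 1) (trans (ℤ.pos-+ 1 (a ℕ.* p)) (cong (λ m → + 1 + m) (ℤ.pos-* a p))) ⟩
      + 1 + + a * + p - + 1      ≡⟨ lemma (+ a * + p) ⟩
      + a * + p                  ∎))
    where
    open ≡-Reasoning
    lemma : ∀ m → + 1 + m - + 1 ≡ m
    lemma = solve-∀
  ... | Bézout.+- a b 1+bn≡ap = 𝟎 ⊟ b mod p ,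
    transfer≈ (Ι Fin.zero ⊗ (Κ (+ 0) ⊖ Κ (+ b))) (Κ (+ 1)) (x ∷ []) (≈-by-multiple (- + a) (begin
      ⟦ x ⟧ℤ * (+ 0 - + b) - + 1    ≡⟨ lemma ⟦ x ⟧ℤ (+ b) ⟩
      - (+ 1 + + b * ⟦ x ⟧ℤ)        ≡⟨ cong (λ m → - (+ 1 + m)) (sym (ℤ.pos-* b (toℕ x))) ⟩
      - + (1 ℕ.+ b ℕ.* toℕ x)       ≡⟨ cong (λ m → - + m) 1+bn≡ap ⟩
      - + (a ℕ.* p)                 ≡⟨ cong -_ (ℤ.pos-* a p) ⟩
      - (+ a * + p)                 ≡⟨ ℤ.neg-distribˡ-* (+ a) (+ p) ⟩
      - + a * + p                   ∎))
    where
    open ≡-Reasoning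
    lemma : ∀ n b → n * (+ 0 - b) - + 1 ≡ - (+ 1 + b * n)
    lemma = solve-∀

  lines-meet-once : ∀ {x y x′ y′ ξ ζ} → (x , y) ≢ (x′ , y′) →
                    x ⊞ ξ ⊠ y ≡ x′ ⊞ ξ ⊠ y′ → x ⊞ ζ ⊠ y ≡ x′ ⊞ ζ ⊠ y′ → ξ ≡ ζ
  lines-meet-once {x} {y} {x′} {y′} {ξ} {ζ} distinct meet-ξ meet-ζ =
    Sum.[ ⊟≡𝟎⇒≡ {ξ} {ζ} , parallel ] (⊠-integral {ξ ⊟ ζ} {y ⊟ y′} product≡𝟎)
    where
    open ≡-Reasoning
    product≡𝟎 : (ξ ⊟ ζ) ⊠ (y ⊟ y′) ≡ 𝟎
    product≡𝟎 = begin
      (ξ ⊟ ζ) ⊠ (y ⊟ y′)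
        ≡⟨ solveₚ 6 (λ x y x′ y′ ξ ζ →
                       (ξ ⊖ ζ) ⊗ (y ⊖ y′) := (x ⊕ ξ ⊗ y ⊖ (x′ ⊕ ξ ⊗ y′)) ⊖ (x ⊕ ζ ⊗ y ⊖ (x′ ⊕ ζ ⊗ y′)))
                     refl x y x′ y′ ξ ζ ⟩
      (x ⊞ ξ ⊠ y ⊟ (x′ ⊞ ξ ⊠ y′)) ⊟ (x ⊞ ζ ⊠ y ⊟ (x′ ⊞ ζ ⊠ y′))
        ≡⟨ cong₂ _⊟_ (≡⇒⊟≡𝟎 meet-ξ) (≡⇒⊟≡𝟎 meet-ζ) ⟩
      𝟎 ⊟ 𝟎
        ≡⟨ x⊟x≡𝟎 𝟎 ⟩
      𝟎 ∎
    parallel : y ⊟ y′ ≡ 𝟎 → ξ ≡ ζ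
    parallel y-y′≡𝟎 = ⊥-elim (distinct (cong₂ _,_ x≡x′ y≡y′))
      where
      y≡y′ : y ≡ y′
      y≡y′ = ⊟≡𝟎⇒≡ {y} {y′} y-y′≡𝟎
      x≡x′ : x ≡ x′
      x≡x′ = ⊞-cancelʳ (ξ ⊠ y) (trans meet-ξ (cong (λ t → x′ ⊞ ξ ⊠ t) (sym y≡y′)))

  ∃-nonzero-powSet : ∀ {Y y} → y ∈ Y → y ≢ 𝟎 → ∀ m → ∃[ w ] w ∈ powSet p m Y × w ≢ 𝟎
  ∃-nonzero-powSet {Y} y∈Y y≢𝟎 zero    = 𝟏 , 𝟏∈powSet-zero {Y} , 𝟏≢𝟎
  ∃-nonzero-powSet {Y} y∈Y y≢𝟎 (suc m) with w , w∈ , w≢𝟎 ← ∃-nonzero-powSet y∈Y y≢𝟎 m =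
    _ , ∈-powSet-suc⁺ {m} {Y} y∈Y w∈ , ⊠-≢𝟎 y≢𝟎 w≢𝟎

  infix 8 _·_
  _·_ : ℕ → Fin p → Fin p
  j · x = j mod p ⊠ x

  0·x≡𝟎 : ∀ x → 0 · x ≡ 𝟎
  0·x≡𝟎 = solveₚ 1 (λ x → Κ (+ 0) ⊗ x := Κ (+ 0)) refl

  ·-suc : ∀ j x → suc j · x ≡ j · x ⊞ x
  ·-suc j x = transfer≈ (Κ (+ suc j) ⊗ Ι Fin.zero) (Κ (+ j) ⊗ Ι Fin.zero ⊕ Ι Fin.zero) (x ∷ [])
                (≈-reflexive (lemma (+ j) ⟦ x ⟧ℤ))
    where
    lemma : ∀ j x → (+ 1 + j) * x ≡ j * x + x
    lemma = solve-∀

  ∃-multiple : ∀ {x} → x ≢ 𝟎 → ∀ y → ∃[ j ] j · x ≡ y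
  ∃-multiple {x} x≢𝟎 y with μ , xμ≡𝟏 ← ⊠-inverse x≢𝟎 = toℕ (y ⊠ μ) , (begin
    toℕ (y ⊠ μ) mod p ⊠ x    ≡⟨ transfer≈ (Κ (+ toℕ (y ⊠ μ)) ⊗ Ι (Fin.suc Fin.zero))
                                          (Ι Fin.zero ⊗ Ι (Fin.suc Fin.zero)) (y ⊠ μ ∷ x ∷ []) (≈-reflexive refl) ⟩
    y ⊠ μ ⊠ x                ≡⟨ solveₚ 3 (λ y μ x → y ⊗ μ ⊗ x := y ⊗ (x ⊗ μ)) refl y μ x ⟩
    y ⊠ (x ⊠ μ)              ≡⟨ cong (y ⊠_) xμ≡𝟏 ⟩
    y ⊠ 𝟏                    ≡⟨ solveₚ 1 (λ y → y ⊗ Κ (+ 1) := y) refl y ⟩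
    y                        ∎)
    where open ≡-Reasoning

open import Data.Nat using (_+_; _*_)
open import Data.Nat.Properties
  using (+-identityʳ; *-identityˡ; *-identityʳ; *-distribˡ-+; +-mono-≤; *-monoˡ-≤; *-monoʳ-≤;
         *-cancelˡ-≤; *-cancelʳ-≤; ≤-trans; ≤-reflexive; ≤-total; m≤m+n; m≤n+m; m≤n⇒∃[o]m+o≡n;
         ≰⇒>; n≮n; <-trans; 0≢1+n; m<n⇒0<n∸m; +-comm; *-comm; *-commutativeSemigroup; +-*-semiring;
         module ≤-Reasoning)
open import Data.Nat.Tactic.RingSolver using (solve-∀)
open import Algebra.Properties.CommutativeSemigroup *-commutativeSemigroup using (x∙yz≈y∙xz)
open import Algebra.Properties.Semiring.Sum +-*-semiring
  using (sum-syntax; sum-cong-≗; ∑-distrib-+; ∑-comm; *-distribˡ-sum; *-distribʳ-sum; sum-replicate-zero)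

-- Counting

𝟙[_] : ∀ {a} {A : Set a} → Dec A → ℕ
𝟙[ d ] = if does d then 1 else 0

𝟙≤1 : ∀ {a} {A : Set a} (d : Dec A) → 𝟙[ d ] ≤ 1
𝟙≤1 (yes _) = s≤s z≤n
𝟙≤1 (no _)  = z≤n

𝟙-idem : ∀ {a} {A : Set a} (d : Dec A) → 𝟙[ d ] * 𝟙[ d ] ≡ 𝟙[ d ]
𝟙-idem (yes _) = refl
𝟙-idem (no _)  = refl

𝟙-yes : ∀ {a} {A : Set a} (d : Dec A) → A → 𝟙[ d ] ≡ 1
𝟙-yes (yes _) _ = refl
𝟙-yes (no ¬a) a = contradiction a ¬a

𝟙-no : ∀ {a} {A : Set a} (d : Dec A) → ¬ A → 𝟙[ d ] ≡ 0
𝟙-no (yes a) ¬a = contradiction a ¬a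
𝟙-no (no _)  _  = refl

𝟙-cong : ∀ {a b} {A : Set a} {B : Set b} → A ⇔ B → (d : Dec A) (e : Dec B) → 𝟙[ d ] ≡ 𝟙[ e ]
𝟙-cong A⇔B (yes a) e = sym (𝟙-yes e (Equivalence.to A⇔B a))
𝟙-cong A⇔B (no ¬a) e = sym (𝟙-no e (λ b → ¬a (Equivalence.from A⇔B b)))

∑-mono-≤ : ∀ {n} {f g : Fin n → ℕ} → (∀ i → f i ≤ g i) → ∑[ i < n ] f i ≤ ∑[ i < n ] g i
∑-mono-≤ {zero}  f≤g = z≤n
∑-mono-≤ {suc n} f≤g = +-mono-≤ (f≤g Fin.zero) (∑-mono-≤ (λ i → f≤g (Fin.suc i)))

∑-const : ∀ n c → ∑[ i < n ] c ≡ n * c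
∑-const zero    c = refl
∑-const (suc n) c = cong (c +_) (∑-const n c)

∑-δ : ∀ {n} (a : Fin n) (f : Fin n → ℕ) → ∑[ t < n ] (𝟙[ a ≟ t ] * f t) ≡ f a
∑-δ {suc n} Fin.zero    f =
  trans (cong₂ _+_ (*-identityˡ (f Fin.zero)) (sum-replicate-zero n)) (+-identityʳ (f Fin.zero))
∑-δ {suc n} (Fin.suc a) f = ∑-δ a (λ t → f (Fin.suc t))

∑-δ≡1 : ∀ {n} (a : Fin n) → ∑[ t < n ] 𝟙[ a ≟ t ] ≡ 1
∑-δ≡1 {n} a = trans (sum-cong-≗ {n} (λ t → sym (*-identityʳ 𝟙[ a ≟ t ]))) (∑-δ a (λ _ → 1))

∑-*-∑ : ∀ {m n} (f : Fin m → ℕ) (g : Fin n → ℕ) →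
        (∑[ i < m ] f i) * (∑[ j < n ] g j) ≡ ∑[ i < m ] ∑[ j < n ] (f i * g j)
∑-*-∑ {m} {n} f g = trans (*-distribʳ-sum (∑[ j < n ] g j) f) (sum-cong-≗ {m} (λ i → *-distribˡ-sum (f i) g))

∣S∣≡∑𝟙 : ∀ {n} (S : Subset n) → ∣ S ∣ ≡ ∑[ t < n ] 𝟙[ t ∈? S ]
∣S∣≡∑𝟙 []            = refl
∣S∣≡∑𝟙 (inside  ∷ S) = cong suc (∣S∣≡∑𝟙 S)
∣S∣≡∑𝟙 (outside ∷ S) = ∣S∣≡∑𝟙 S

∑𝟙≤1 : ∀ {n p} {P : Fin n → Set p} (P? : Decidable P) → (∀ {i j} → P i → P j → i ≡ j) → ∑[ t < n ] 𝟙[ P? t ] ≤ 1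
∑𝟙≤1 {n} P? unique with Fin.any? P?
... | yes (i , Pi) = ≤-trans (∑-mono-≤ below) (≤-reflexive (∑-δ≡1 i))
  where
  below : ∀ t → 𝟙[ P? t ] ≤ 𝟙[ i ≟ t ]
  below t with P? t
  ... | no _   = z≤n
  ... | yes Pt = ≤-reflexive (sym (𝟙-yes (i ≟ t) (unique Pi Pt)))
... | no ∄P = ≤-trans (≤-reflexive (trans (sum-cong-≗ {n} none) (sum-replicate-zero n))) z≤n
  where
  none : ∀ t → 𝟙[ P? t ] ≡ 0
  none t = 𝟙-no (P? t) (λ Pt → ∄P (t , Pt))

2mn≤m²+n² : ∀ m n → 2 * (m * n) ≤ m * m + n * n
2mn≤m²+n² m n = Sum.[ ordered , flipped ]′ (≤-total m n)
  where
  square-gap : ∀ m d → 2 * (m * (m + d)) + d * d ≡ m * m + (m + d) * (m + d)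
  square-gap = solve-∀
  ordered : ∀ {m n} → m ≤ n → 2 * (m * n) ≤ m * m + n * n
  ordered {m} m≤n with d , refl ← m≤n⇒∃[o]m+o≡n m≤n =
    subst (2 * (m * (m + d)) ≤_) (square-gap m d) (m≤m+n _ (d * d))
  flipped : n ≤ m → 2 * (m * n) ≤ m * m + n * n
  flipped n≤m = subst₂ _≤_ (cong (2 *_) (*-comm n m)) (+-comm (n * n) (m * m)) (ordered n≤m)

cauchy-schwarz : ∀ {n} (a b : Fin n → ℕ) →
                 (∑[ i < n ] (a i * b i)) * (∑[ i < n ] (a i * b i))
                   ≤ (∑[ i < n ] (a i * a i)) * (∑[ i < n ] (b i * b i))
cauchy-schwarz {n} a b = *-cancelˡ-≤ 2 (begin
  2 * (∑[ i < n ] ab i * ∑[ j < n ] ab j)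
    ≡⟨ cong (2 *_) (∑-*-∑ ab ab) ⟩
  2 * ∑[ i < n ] ∑[ j < n ] (ab i * ab j)
    ≡⟨ *-distribˡ-sum {n} 2 (λ i → ∑[ j < n ] (ab i * ab j)) ⟩
  ∑[ i < n ] (2 * ∑[ j < n ] (ab i * ab j))
    ≡⟨ sum-cong-≗ {n} (λ i → trans (*-distribˡ-sum {n} 2 (λ j → ab i * ab j))
                                   (sum-cong-≗ {n} (λ j → cong (2 *_) (swap (a i) (b i) (a j) (b j))))) ⟩
  ∑[ i < n ] ∑[ j < n ] (2 * (u i j * u j i))
    ≤⟨ ∑-mono-≤ (λ i → ∑-mono-≤ (λ j → 2mn≤m²+n² (u i j) (u j i))) ⟩
  ∑[ i < n ] ∑[ j < n ] (u i j * u i j + u j i * u j i)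
    ≡⟨ sum-cong-≗ {n} (λ i → ∑-distrib-+ {n} (λ j → u i j * u i j) (λ j → u j i * u j i)) ⟩
  ∑[ i < n ] (∑[ j < n ] (u i j * u i j) + ∑[ j < n ] (u j i * u j i))
    ≡⟨ ∑-distrib-+ {n} (λ i → ∑[ j < n ] (u i j * u i j)) (λ i → ∑[ j < n ] (u j i * u j i)) ⟩
  ∑[ i < n ] ∑[ j < n ] (u i j * u i j) + ∑[ i < n ] ∑[ j < n ] (u j i * u j i)
    ≡⟨ cong₂ _+_ ∑∑u² (trans (∑-comm {n} {n} (λ i j → u j i * u j i)) ∑∑u²) ⟩
  P * Q + P * Q
    ≡⟨ cong (P * Q +_) (sym (+-identityʳ (P * Q))) ⟩
  2 * (P * Q)
    ∎)
  where
  open ≤-Reasoning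
  ab : Fin n → ℕ
  ab i = a i * b i
  u : Fin n → Fin n → ℕ
  u i j = a i * b j
  P Q : ℕ
  P = ∑[ i < n ] (a i * a i)
  Q = ∑[ i < n ] (b i * b i)
  swap : ∀ x y z w → (x * y) * (z * w) ≡ (x * w) * (z * y)
  swap = solve-∀
  square : ∀ x y → (x * y) * (x * y) ≡ (x * x) * (y * y)
  square = solve-∀
  ∑∑u² : ∑[ i < n ] ∑[ j < n ] (u i j * u i j) ≡ P * Q
  ∑∑u² = sym (trans (∑-*-∑ (λ i → a i * a i) (λ j → b j * b j))
                    (sum-cong-≗ {n} (λ i → sum-cong-≗ {n} (λ j → sym (square (a i) (b j))))))

∃-below-average : ∀ {n} (S : Subset n) (f : Fin n → ℕ) → 0 < ∣ S ∣ →
                  ∃[ i ] ∣ S ∣ * f i ≤ ∑[ t < n ] (𝟙[ t ∈? S ] * f t)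
∃-below-average {n} S f 0<∣S∣ = decide (Fin.any? (λ i → ∣ S ∣ * f i ≤? average))
  where
  open ≤-Reasoning
  average : ℕ
  average = ∑[ t < n ] (𝟙[ t ∈? S ] * f t)
  decide : Dec (∃[ i ] ∣ S ∣ * f i ≤ average) → ∃[ i ] ∣ S ∣ * f i ≤ average
  decide (yes below) = below
  decide (no ∄below) = contradiction (*-cancelˡ-≤ ∣ S ∣ {{>-nonZero 0<∣S∣}} (begin
    ∣ S ∣ * suc average                              ≡⟨ cong (_* suc average) (∣S∣≡∑𝟙 S) ⟩
    (∑[ t < n ] 𝟙[ t ∈? S ]) * suc average           ≡⟨ *-distribʳ-sum (suc average) (λ t → 𝟙[ t ∈? S ]) ⟩
    ∑[ t < n ] (𝟙[ t ∈? S ] * suc average)           ≤⟨ ∑-mono-≤ (λ t → *-monoʳ-≤ 𝟙[ t ∈? S ] (above t)) ⟩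
    ∑[ t < n ] (𝟙[ t ∈? S ] * (∣ S ∣ * f t))         ≡⟨ sum-cong-≗ {n} (λ t → x∙yz≈y∙xz 𝟙[ t ∈? S ] ∣ S ∣ (f t)) ⟩
    ∑[ t < n ] (∣ S ∣ * (𝟙[ t ∈? S ] * f t))         ≡⟨ *-distribˡ-sum ∣ S ∣ (λ t → 𝟙[ t ∈? S ] * f t) ⟨
    ∣ S ∣ * average                                  ∎)) (n≮n average)
    where
    above : ∀ t → average < ∣ S ∣ * f t
    above t = ≰⇒> (λ below → ∄below (t , below))

module _ {N n : ℕ} (g : Fin N → Fin n) where

  collisions : ℕ
  collisions = ∑[ i < N ] ∑[ j < N ] 𝟙[ g i ≟ g j ]

  private
    fibre : Fin n → ℕ
    fibre t = ∑[ i < N ] 𝟙[ g i ≟ t ]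

    ∑-fibre : ∑[ t < n ] fibre t ≡ N
    ∑-fibre = begin
      ∑[ t < n ] ∑[ i < N ] 𝟙[ g i ≟ t ]   ≡⟨ ∑-comm {n} {N} (λ t i → 𝟙[ g i ≟ t ]) ⟩
      ∑[ i < N ] ∑[ t < n ] 𝟙[ g i ≟ t ]   ≡⟨ sum-cong-≗ {N} (λ i → ∑-δ≡1 (g i)) ⟩
      ∑[ i < N ] 1                         ≡⟨ trans (∑-const N 1) (*-identityʳ N) ⟩
      N                                    ∎
      where open ≡-Reasoning

    ∑-fibre² : ∑[ t < n ] (fibre t * fibre t) ≡ collisions
    ∑-fibre² = begin
      ∑[ t < n ] (fibre t * fibre t)
        ≡⟨ sum-cong-≗ {n} (λ t → *-distribʳ-sum (fibre t) (λ i → 𝟙[ g i ≟ t ])) ⟩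
      ∑[ t < n ] ∑[ i < N ] (𝟙[ g i ≟ t ] * fibre t)
        ≡⟨ ∑-comm {n} {N} (λ t i → 𝟙[ g i ≟ t ] * fibre t) ⟩
      ∑[ i < N ] ∑[ t < n ] (𝟙[ g i ≟ t ] * fibre t)
        ≡⟨ sum-cong-≗ {N} (λ i → ∑-δ (g i) fibre) ⟩
      ∑[ i < N ] ∑[ j < N ] 𝟙[ g j ≟ g i ]
        ≡⟨ ∑-comm {N} {N} (λ i j → 𝟙[ g j ≟ g i ]) ⟩
      collisions
        ∎
      where open ≡-Reasoning

  collisions-lower-bound : ∀ (Z : Subset n) → (∀ i → g i ∈ Z) → N * N ≤ ∣ Z ∣ * collisions
  collisions-lower-bound Z g∈Z = begin
    N * N                                                          ≡⟨ cong₂ _*_ ∑𝟙fibre ∑𝟙fibre ⟨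
    (∑[ t < n ] (𝟙Z t * fibre t)) * (∑[ t < n ] (𝟙Z t * fibre t))  ≤⟨ cauchy-schwarz 𝟙Z fibre ⟩
    (∑[ t < n ] (𝟙Z t * 𝟙Z t)) * (∑[ t < n ] (fibre t * fibre t))  ≡⟨ cong₂ _*_ ∑𝟙Z² ∑-fibre² ⟩
    ∣ Z ∣ * collisions                                             ∎
    where
    open ≤-Reasoning
    𝟙Z : Fin n → ℕ
    𝟙Z t = 𝟙[ t ∈? Z ]
    ∑𝟙Z² : ∑[ t < n ] (𝟙Z t * 𝟙Z t) ≡ ∣ Z ∣
    ∑𝟙Z² = trans (sum-cong-≗ {n} (λ t → 𝟙-idem (t ∈? Z))) (sym (∣S∣≡∑𝟙 Z))
    supported : ∀ t → 𝟙Z t * fibre t ≡ fibre t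
    supported t with t ∈? Z
    ... | yes _  = +-identityʳ (fibre t)
    ... | no t∉Z =
      sym (trans (sum-cong-≗ {N} (λ i → 𝟙-no (g i ≟ t) (λ { refl → t∉Z (g∈Z i) }))) (sum-replicate-zero N))
    ∑𝟙fibre : ∑[ t < n ] (𝟙Z t * fibre t) ≡ N
    ∑𝟙fibre = trans (sum-cong-≗ {n} supported) ∑-fibre

collisions-cong : ∀ {N m n} {g : Fin N → Fin m} {h : Fin N → Fin n} →
                  (∀ i j → (g i ≡ g j) ⇔ (h i ≡ h j)) → collisions g ≡ collisions h
collisions-cong {N} {g = g} {h} g⇔h =
  sum-cong-≗ {N} (λ i → sum-cong-≗ {N} (λ j → 𝟙-cong (g⇔h i j) (g i ≟ g j) (h i ≟ h j)))

collisions-injective : ∀ {N n} {g : Fin N → Fin n} → Injective _≡_ _≡_ g → collisions g ≡ N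
collisions-injective {N} {g = g} g-injective = begin
  collisions g                       ≡⟨ collisions-cong {h = λ i → i} (λ i j → mk⇔ g-injective (cong g)) ⟩
  ∑[ i < N ] ∑[ j < N ] 𝟙[ i ≟ j ]   ≡⟨ sum-cong-≗ {N} (λ i → ∑-δ≡1 i) ⟩
  ∑[ i < N ] 1                       ≡⟨ trans (∑-const N 1) (*-identityʳ N) ⟩
  N                                  ∎
  where open ≡-Reasoning

injective⇒≤∣S∣ : ∀ {N n} {g : Fin N → Fin n} (S : Subset n) → Injective _≡_ _≡_ g → (∀ i → g i ∈ S) → N ≤ ∣ S ∣
injective⇒≤∣S∣ {zero}  S g-injective g∈S = z≤n
injective⇒≤∣S∣ {suc N} S g-injective g∈S = *-cancelʳ-≤ (suc N) _ _
  (subst (λ c → suc N * suc N ≤ ∣ S ∣ * c) (collisions-injective g-injective) (collisions-lower-bound _ S g∈S))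

enum : ∀ {n} (S : Subset n) → Fin ∣ S ∣ → Fin n
enum (outside ∷ S) i           = Fin.suc (enum S i)
enum (inside  ∷ S) Fin.zero    = Fin.zero
enum (inside  ∷ S) (Fin.suc i) = Fin.suc (enum S i)

enum-∈ : ∀ {n} (S : Subset n) i → enum S i ∈ S
enum-∈ (outside ∷ S) i           = there (enum-∈ S i)
enum-∈ (inside  ∷ S) Fin.zero    = here
enum-∈ (inside  ∷ S) (Fin.suc i) = there (enum-∈ S i)

enum-injective : ∀ {n} (S : Subset n) → Injective _≡_ _≡_ (enum S)
enum-injective (outside ∷ S) eq                     = enum-injective S (Fin.suc-injective eq)
enum-injective (inside  ∷ S) {Fin.zero}  {Fin.zero}  eq = refl
enum-injective (inside  ∷ S) {Fin.suc i} {Fin.suc j} eq = cong Fin.suc (enum-injective S (Fin.suc-injective eq))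

∃-distinct-pair : ∀ {n} (S : Subset n) → 1 < ∣ S ∣ → ∃[ a ] ∃[ b ] a ∈ S × b ∈ S × a ≢ b
∃-distinct-pair S 1<∣S∣ =
  enum S i₀ , enum S i₁ , enum-∈ S i₀ , enum-∈ S i₁ ,
  λ eq → 0≢1+n (trans (sym (toℕ-fromℕ< _)) (trans (cong toℕ (enum-injective S eq)) (toℕ-fromℕ< 1<∣S∣)))
  where
  i₀ i₁ : Fin ∣ S ∣
  i₀ = fromℕ< (<-trans z<s 1<∣S∣)
  i₁ = fromℕ< 1<∣S∣

remQuot-injective : ∀ {m} n → Injective _≡_ _≡_ (remQuot {m} n)
remQuot-injective {m} n {i} {j} eq =
  trans (sym (combine-remQuot {m} n i)) (trans (cong (uncurry Fin.combine) eq) (combine-remQuot {m} n j))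

crossing : ∀ {ℓ} {P : ℕ → Set ℓ} → Decidable P → P 0 → ∀ {n} → ¬ P n → ∃[ j ] P j × ¬ P (suc j)
crossing P? P0 {zero}  ¬P0 = contradiction P0 ¬P0
crossing P? P0 {suc n} ¬P[1+n] with P? n
... | yes Pn  = n , Pn , ¬P[1+n]
... | no  ¬Pn = crossing P? P0 ¬Pn

module LineEnergy (p : ℕ) (pr : Prime p) {N : ℕ} (x y : Fin N → Fin p)
                  (distinct : ∀ {i j} → (x i , y i) ≡ (x j , y j) → i ≡ j) where

  open PrimeField p pr

  energy : Fin p → ℕ
  energy ξ = collisions (λ i → x i ⊞ ξ ⊠ y i)

  ∑-energy≤ : ∀ (S : Subset p) → ∑[ ξ < p ] (𝟙[ ξ ∈? S ] * energy ξ) ≤ N * ∣ S ∣ + N * N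
  ∑-energy≤ S = begin
    ∑[ ξ < p ] (𝟙S ξ * ∑[ i < N ] ∑[ j < N ] meet ξ i j)
      ≡⟨ sum-cong-≗ {p} (λ ξ → trans (*-distribˡ-sum (𝟙S ξ) (λ i → ∑[ j < N ] meet ξ i j))
                                     (sum-cong-≗ {N} (λ i → *-distribˡ-sum (𝟙S ξ) (meet ξ i)))) ⟩
    ∑[ ξ < p ] ∑[ i < N ] ∑[ j < N ] (𝟙S ξ * meet ξ i j)
      ≡⟨ trans (∑-comm {p} {N} _) (sum-cong-≗ {N} (λ i → ∑-comm {p} {N} (λ ξ j → 𝟙S ξ * meet ξ i j))) ⟩
    ∑[ i < N ] ∑[ j < N ] ∑[ ξ < p ] (𝟙S ξ * meet ξ i j)
      ≤⟨ ∑-mono-≤ (λ i → ∑-mono-≤ (λ j → pair-bound i j)) ⟩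
    ∑[ i < N ] ∑[ j < N ] (𝟙[ i ≟ j ] * ∣ S ∣ + 1)
      ≡⟨ sum-cong-≗ {N} (λ i → trans (∑-distrib-+ {N} (λ j → 𝟙[ i ≟ j ] * ∣ S ∣) (λ _ → 1))
                                      (cong₂ _+_ (∑-δ i (λ _ → ∣ S ∣)) (trans (∑-const N 1) (*-identityʳ N)))) ⟩
    ∑[ i < N ] (∣ S ∣ + N)
      ≡⟨ trans (∑-const N _) (*-distribˡ-+ N ∣ S ∣ N) ⟩
    N * ∣ S ∣ + N * N
      ∎
    where
    open ≤-Reasoning
    𝟙S : Fin p → ℕ
    𝟙S ξ = 𝟙[ ξ ∈? S ]
    meet : Fin p → Fin N → Fin N → ℕ
    meet ξ i j = 𝟙[ x i ⊞ ξ ⊠ y i ≟ x j ⊞ ξ ⊠ y j ]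
    pair-bound : ∀ i j → ∑[ ξ < p ] (𝟙S ξ * meet ξ i j) ≤ 𝟙[ i ≟ j ] * ∣ S ∣ + 1
    pair-bound i j with i ≟ j
    ... | yes refl = begin
      ∑[ ξ < p ] (𝟙S ξ * meet ξ i i)   ≤⟨ ∑-mono-≤ (λ ξ → *-monoʳ-≤ (𝟙S ξ) (𝟙≤1 (x i ⊞ ξ ⊠ y i ≟ x i ⊞ ξ ⊠ y i))) ⟩
      ∑[ ξ < p ] (𝟙S ξ * 1)            ≡⟨ trans (sum-cong-≗ {p} (λ ξ → *-identityʳ (𝟙S ξ))) (sym (∣S∣≡∑𝟙 S)) ⟩
      ∣ S ∣                            ≤⟨ m≤m+n ∣ S ∣ 1 ⟩
      ∣ S ∣ + 1                        ≡⟨ cong (_+ 1) (*-identityˡ ∣ S ∣) ⟨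
      1 * ∣ S ∣ + 1                    ∎
    ... | no i≢j = begin
      ∑[ ξ < p ] (𝟙S ξ * meet ξ i j)   ≤⟨ ∑-mono-≤ (λ ξ → *-monoˡ-≤ (meet ξ i j) (𝟙≤1 (ξ ∈? S))) ⟩
      ∑[ ξ < p ] (1 * meet ξ i j)      ≡⟨ sum-cong-≗ {p} (λ ξ → *-identityˡ (meet ξ i j)) ⟩
      ∑[ ξ < p ] meet ξ i j            ≤⟨ ∑𝟙≤1 (λ ξ → x i ⊞ ξ ⊠ y i ≟ x j ⊞ ξ ⊠ y j)
                                             (lines-meet-once (λ eq → i≢j (distinct eq))) ⟩
      1                                ∎

≤-from-energy : ∀ {N m Z E} → N * N ≤ Z * E → m * E ≤ N * m + N * N → N * m ≤ Z * (N + m)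
≤-from-energy {zero}                  _      _   = z≤n
≤-from-energy {N@(suc _)} {m} {Z} {E} N²≤ZE mE≤ = *-cancelˡ-≤ N (begin
  N * (N * m)          ≡⟨ reorder N m ⟩
  m * (N * N)          ≤⟨ *-monoʳ-≤ m N²≤ZE ⟩
  m * (Z * E)          ≡⟨ x∙yz≈y∙xz m Z E ⟩
  Z * (m * E)          ≤⟨ *-monoʳ-≤ Z mE≤ ⟩
  Z * (N * m + N * N)  ≡⟨ factor N m Z ⟩
  N * (Z * (N + m))    ∎)
  where
  open ≤-Reasoning
  reorder : ∀ N m → N * (N * m) ≡ m * (N * N)
  reorder = solve-∀
  factor : ∀ N m Z → Z * (N * m + N * N) ≡ N * (Z * (N + m))
  factor = solve-∀

≤-from-injection : ∀ {N m Z} → N ≤ Z → N * m ≤ Z * (N + m)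
≤-from-injection {N} {m} {Z} N≤Z = ≤-trans (*-monoˡ-≤ m N≤Z) (*-monoʳ-≤ Z (m≤n+m m N))

-- The parameter k is the paper's k - 1.
module Bound (p : ℕ) (pr : Prime p) (K k : ℕ) (Y : Subset p) (1<∣Y∣ : 1 < ∣ Y ∣) where

  open PrimeField p pr
  open import Data.Integer using (+_)

  A X B Z : Subset p
  A = sumSet p K (powSet p (suc k) Y)
  X = diffSet p A A
  B = sumSet p (4 * K + 1) (powSet p (suc (suc k)) Y)
  Z = diffSet p B B

  N m : ℕ
  N = ∣ X ∣ * ∣ Y ∣
  m = p ∸ 1

  Ratio : Fin p → Set
  Ratio ξ = ∃₂ λ a b → ∃₂ λ c d → a ∈ X × b ∈ X × c ∈ Y × d ∈ Y × c ≢ d × ξ ⊠ (c ⊟ d) ≡ a ⊟ b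

  ratio? : Decidable Ratio
  ratio? ξ = Fin.any? λ a → Fin.any? λ b → Fin.any? λ c → Fin.any? λ d →
    a ∈? X ×-dec b ∈? X ×-dec c ∈? Y ×-dec d ∈? Y ×-dec ¬? (c ≟ d) ×-dec ξ ⊠ (c ⊟ d) ≟ a ⊟ b

  private
    Yᵏ⁺² : Subset p
    Yᵏ⁺² = powSet p (suc (suc k)) Y

    four-K+1 : ∀ K → K + (K + (K + (K + 1))) ≡ 4 * K + 1
    four-K+1 = solve-∀

    ∈B : ∀ {t₁ t₂ t₃ t₄ e} → t₁ ∈ sumSet p K Yᵏ⁺² → t₂ ∈ sumSet p K Yᵏ⁺² → t₃ ∈ sumSet p K Yᵏ⁺² →
         t₄ ∈ sumSet p K Yᵏ⁺² → e ∈ Yᵏ⁺² → t₁ ⊞ (t₂ ⊞ (t₃ ⊞ (t₄ ⊞ (e ⊞ 𝟎)))) ∈ B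
    ∈B {t₁} {t₂} {t₃} {t₄} {e} t₁∈ t₂∈ t₃∈ t₄∈ e∈ =
      subst (λ n → t₁ ⊞ (t₂ ⊞ (t₃ ⊞ (t₄ ⊞ (e ⊞ 𝟎)))) ∈ sumSet p n Yᵏ⁺²) (four-K+1 K)
        (∈-sumSet-+ K _ t₁∈ (∈-sumSet-+ K _ t₂∈ (∈-sumSet-+ K _ t₃∈
          (∈-sumSet-+ K 1 t₄∈ (∈-sumSet-suc⁺ {0} {Yᵏ⁺²} e∈ (𝟎∈sumSet-zero {Yᵏ⁺²}))))))

    ⊠∈ : ∀ {c u} → c ∈ Y → u ∈ A → c ⊠ u ∈ sumSet p K Yᵏ⁺²
    ⊠∈ {c} c∈Y u∈A = ∈-sumSet-scale K {powSet p (suc k) Y} {Yᵏ⁺²} {c} (∈-powSet-suc⁺ {suc k} {Y} c∈Y) u∈A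

  -- Writing x, a, b as differences of elements of KY^{k+1}, (c - d)(x + ζy) expands into a difference
  -- of two sums of 4K + 1 elements of Y^{k+2}: this is where 4K + 1 comes from.
  dilation-∈Z : ∀ ξ ζ {a b c d e₁ e₂ x y} → a ∈ X → b ∈ X → c ∈ Y → d ∈ Y → ξ ⊠ (c ⊟ d) ≡ a ⊟ b →
                e₁ ∈ Yᵏ⁺² → e₂ ∈ Yᵏ⁺² → (ζ ⊟ ξ) ⊠ (c ⊟ d) ⊠ y ≡ e₁ ⊟ e₂ → x ∈ X → y ∈ Y →
                (c ⊟ d) ⊠ (x ⊞ ζ ⊠ y) ∈ Z
  dilation-∈Z ξ ζ {c = c} {d} {e₁} {e₂} {y = y} a∈X b∈X c∈Y d∈Y ratio e₁∈ e₂∈ shift x∈X y∈Y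
    with u₁ , v₁ , u₁∈ , v₁∈ , refl ← ∈-diffSet⁻ a∈X
       | u₂ , v₂ , u₂∈ , v₂∈ , refl ← ∈-diffSet⁻ b∈X
       | u  , v  , u∈  , v∈  , refl ← ∈-diffSet⁻ x∈X
    = subst (_∈ Z) (sym expand) (∈-diffSet⁺ (∈B (⊠∈ c∈Y u∈) (⊠∈ d∈Y v∈) (⊠∈ y∈Y u₁∈) (⊠∈ y∈Y v₂∈) e₁∈)
                                             (∈B (⊠∈ d∈Y u∈) (⊠∈ c∈Y v∈) (⊠∈ y∈Y v₁∈) (⊠∈ y∈Y u₂∈) e₂∈))
    where
    expand : (c ⊟ d) ⊠ (u ⊟ v ⊞ ζ ⊠ y)
             ≡ (c ⊠ u ⊞ (d ⊠ v ⊞ (y ⊠ u₁ ⊞ (y ⊠ v₂ ⊞ (e₁ ⊞ 𝟎))))) ⊟ (d ⊠ u ⊞ (c ⊠ v ⊞ (y ⊠ v₁ ⊞ (y ⊠ u₂ ⊞ (e₂ ⊞ 𝟎)))))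
    expand = begin
      (c ⊟ d) ⊠ (u ⊟ v ⊞ ζ ⊠ y)
        ≡⟨ solveₚ 7 (λ c d u v y ξ ζ → (c ⊖ d) ⊗ (u ⊖ v ⊕ ζ ⊗ y)
                      := (c ⊖ d) ⊗ (u ⊖ v) ⊕ y ⊗ (ξ ⊗ (c ⊖ d)) ⊕ (ζ ⊖ ξ) ⊗ (c ⊖ d) ⊗ y) refl c d u v y ξ ζ ⟩
      (c ⊟ d) ⊠ (u ⊟ v) ⊞ y ⊠ (ξ ⊠ (c ⊟ d)) ⊞ (ζ ⊟ ξ) ⊠ (c ⊟ d) ⊠ y
        ≡⟨ cong₂ (λ s t → (c ⊟ d) ⊠ (u ⊟ v) ⊞ y ⊠ s ⊞ t) ratio shift ⟩
      (c ⊟ d) ⊠ (u ⊟ v) ⊞ y ⊠ (u₁ ⊟ v₁ ⊟ (u₂ ⊟ v₂)) ⊞ (e₁ ⊟ e₂)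
        ≡⟨ solveₚ 11 (λ c d u v y u₁ v₁ u₂ v₂ e₁ e₂ → (c ⊖ d) ⊗ (u ⊖ v) ⊕ y ⊗ (u₁ ⊖ v₁ ⊖ (u₂ ⊖ v₂)) ⊕ (e₁ ⊖ e₂)
                       := (c ⊗ u ⊕ (d ⊗ v ⊕ (y ⊗ u₁ ⊕ (y ⊗ v₂ ⊕ (e₁ ⊕ Κ (+ 0))))))
                          ⊖ (d ⊗ u ⊕ (c ⊗ v ⊕ (y ⊗ v₁ ⊕ (y ⊗ u₂ ⊕ (e₂ ⊕ Κ (+ 0)))))))
                     refl c d u v y u₁ v₁ u₂ v₂ e₁ e₂ ⟩
      (c ⊠ u ⊞ (d ⊠ v ⊞ (y ⊠ u₁ ⊞ (y ⊠ v₂ ⊞ (e₁ ⊞ 𝟎))))) ⊟ (d ⊠ u ⊞ (c ⊠ v ⊞ (y ⊠ v₁ ⊞ (y ⊠ u₂ ⊞ (e₂ ⊞ 𝟎)))))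
        ∎
      where open ≡-Reasoning

  xᵢ yᵢ : Fin N → Fin p
  xᵢ i = enum X (proj₁ (remQuot {∣ X ∣} ∣ Y ∣ i))
  yᵢ i = enum Y (proj₂ (remQuot {∣ X ∣} ∣ Y ∣ i))

  points-distinct : ∀ {i j} → (xᵢ i , yᵢ i) ≡ (xᵢ j , yᵢ j) → i ≡ j
  points-distinct eq = remQuot-injective {∣ X ∣} ∣ Y ∣
    (cong₂ _,_ (enum-injective X (cong proj₁ eq)) (enum-injective Y (cong proj₂ eq)))

  open LineEnergy p pr xᵢ yᵢ points-distinct using (energy; ∑-energy≤)

  private
    nonzero-in-Y : ∃[ y ] y ∈ Y × y ≢ 𝟎
    nonzero-in-Y with c , d , c∈Y , d∈Y , c≢d ← ∃-distinct-pair Y 1<∣Y∣ with c ≟ 𝟎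
    ... | yes c≡𝟎 = d , d∈Y , λ d≡𝟎 → c≢d (trans c≡𝟎 (sym d≡𝟎))
    ... | no  c≢𝟎 = c , c∈Y , c≢𝟎

    nonzero-power : ∀ j → ∃[ w ] w ∈ powSet p j Y × w ≢ 𝟎
    nonzero-power with y , y∈Y , y≢𝟎 ← nonzero-in-Y = ∃-nonzero-powSet y∈Y y≢𝟎

    X-nonempty : ∃[ x ] x ∈ X
    X-nonempty with w , w∈ , _ ← nonzero-power (suc k) with a , a∈A ← ∃-sumSet w∈ K =
      a ⊟ a , ∈-diffSet⁺ {A} {A} a∈A a∈A

  ratio-𝟎 : Ratio 𝟎
  ratio-𝟎 with c , d , c∈Y , d∈Y , c≢d ← ∃-distinct-pair Y 1<∣Y∣ | x , x∈X ← X-nonempty =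
    x , x , c , d , x∈X , x∈X , c∈Y , d∈Y , c≢d ,
    trans (solveₚ 2 (λ c d → Κ (+ 0) ⊗ (c ⊖ d) := Κ (+ 0)) refl c d) (sym (x⊟x≡𝟎 x))

  bound-at-ratio : ∀ ξ → Ratio ξ → m * energy ξ ≤ N * m + N * N → N * m ≤ ∣ Z ∣ * (N + m)
  bound-at-ratio ξ (a , b , c , d , a∈X , b∈X , c∈Y , d∈Y , c≢d , ratio) =
    ≤-from-energy {N} {m} {∣ Z ∣} {energy ξ} (begin
    N * N                  ≤⟨ collisions-lower-bound g Z g∈Z ⟩
    ∣ Z ∣ * collisions g   ≡⟨ cong (∣ Z ∣ *_) (collisions-cong {g = g} {h = λ i → xᵢ i ⊞ ξ ⊠ yᵢ i}
                                (λ i j → mk⇔ (⊠-cancelˡ (⊟-≢𝟎 c≢d)) (cong ((c ⊟ d) ⊠_)))) ⟩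
    ∣ Z ∣ * energy ξ       ∎)
    where
    open ≤-Reasoning
    g : Fin N → Fin p
    g i = (c ⊟ d) ⊠ (xᵢ i ⊞ ξ ⊠ yᵢ i)
    g∈Z : ∀ i → g i ∈ Z
    g∈Z i with e , e∈ , _ ← nonzero-power (suc (suc k)) =
      dilation-∈Z ξ ξ a∈X b∈X c∈Y d∈Y ratio e∈ e∈ no-shift (enum-∈ X _) (enum-∈ Y _)
      where
      no-shift : (ξ ⊟ ξ) ⊠ (c ⊟ d) ⊠ yᵢ i ≡ e ⊟ e
      no-shift = solveₚ 5 (λ ξ c d y e → (ξ ⊖ ξ) ⊗ (c ⊖ d) ⊗ y := e ⊖ e) refl ξ c d (yᵢ i) e

  injective-off-ratios : ∀ ζ → ¬ Ratio ζ → ∀ {i j} → xᵢ i ⊞ ζ ⊠ yᵢ i ≡ xᵢ j ⊞ ζ ⊠ yᵢ j → i ≡ j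
  injective-off-ratios ζ ¬ratio {i} {j} meet with yᵢ i ≟ yᵢ j
  ... | yes yᵢ≡yⱼ = points-distinct (cong₂ _,_ xᵢ≡xⱼ yᵢ≡yⱼ)
    where
    xᵢ≡xⱼ : xᵢ i ≡ xᵢ j
    xᵢ≡xⱼ = ⊞-cancelʳ (ζ ⊠ yᵢ i) (trans meet (cong (λ t → xᵢ j ⊞ ζ ⊠ t) (sym yᵢ≡yⱼ)))
  ... | no yᵢ≢yⱼ = contradiction
    (xᵢ i , xᵢ j , yᵢ j , yᵢ i , enum-∈ X _ , enum-∈ X _ , enum-∈ Y _ , enum-∈ Y _ , (λ eq → yᵢ≢yⱼ (sym eq)) ,
     slope {xᵢ i} {yᵢ i} {xᵢ j} {yᵢ j} {ζ} meet) ¬ratio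

  ratio-crossing : ∀ η w → w ≢ 𝟎 → ¬ Ratio η → ∃[ ξ ] Ratio ξ × ¬ Ratio (ξ ⊞ w)
  ratio-crossing η w w≢𝟎 ¬ratio-η =
    let j₀ , j₀·w≡η = ∃-multiple w≢𝟎 η
        j , ratio-j , ¬ratio-suc-j = crossing {P = λ j → Ratio (j · w)} (λ j → ratio? (j · w))
          (subst Ratio (sym (0·x≡𝟎 w)) ratio-𝟎) (λ r → ¬ratio-η (subst Ratio j₀·w≡η r))
    in j · w , ratio-j , λ r → ¬ratio-suc-j (subst Ratio (sym (·-suc j w)) r)

  bound-at-crossing : ∀ ξ w → w ∈ powSet p k Y → Ratio ξ → ¬ Ratio (ξ ⊞ w) → N * m ≤ ∣ Z ∣ * (N + m)
  bound-at-crossing ξ w w∈ (a , b , c , d , a∈X , b∈X , c∈Y , d∈Y , c≢d , ratio) ¬ratio-ζ =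
    ≤-from-injection {N} {m} {∣ Z ∣} (injective⇒≤∣S∣ Z g-injective g∈Z)
    where
    ζ : Fin p
    ζ = ξ ⊞ w
    g : Fin N → Fin p
    g i = (c ⊟ d) ⊠ (xᵢ i ⊞ ζ ⊠ yᵢ i)
    g∈Z : ∀ i → g i ∈ Z
    g∈Z i = dilation-∈Z ξ ζ a∈X b∈X c∈Y d∈Y ratio (∈-powSet-suc⁺ {suc k} c∈Y yw∈) (∈-powSet-suc⁺ {suc k} d∈Y yw∈)
                        shift (enum-∈ X _) (enum-∈ Y _)
      where
      yw∈ : yᵢ i ⊠ w ∈ powSet p (suc k) Y
      yw∈ = ∈-powSet-suc⁺ {k} (enum-∈ Y _) w∈
      shift : (ζ ⊟ ξ) ⊠ (c ⊟ d) ⊠ yᵢ i ≡ c ⊠ (yᵢ i ⊠ w) ⊟ d ⊠ (yᵢ i ⊠ w)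
      shift = solveₚ 5 (λ ξ w c d y → (ξ ⊕ w ⊖ ξ) ⊗ (c ⊖ d) ⊗ y := c ⊗ (y ⊗ w) ⊖ d ⊗ (y ⊗ w)) refl ξ w c d (yᵢ i)
    g-injective : ∀ {i j} → g i ≡ g j → i ≡ j
    g-injective eq = injective-off-ratios ζ ¬ratio-ζ (⊠-cancelˡ (⊟-≢𝟎 c≢d) eq)

  bound-off-ratio : ∀ η → ¬ Ratio η → N * m ≤ ∣ Z ∣ * (N + m)
  bound-off-ratio η ¬ratio-η =
    let w , w∈ , w≢𝟎 = nonzero-power k
        ξ , ratio-ξ , ¬ratio-ζ = ratio-crossing η w w≢𝟎 ¬ratio-η
    in bound-at-crossing ξ w w∈ ratio-ξ ¬ratio-ζ

  private
    ∣nonzero∣≡m : ∣ ∁ ⁅ 𝟎 ⁆ ∣ ≡ m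
    ∣nonzero∣≡m = trans (∣∁p∣≡n∸∣p∣ ⁅ 𝟎 ⁆) (cong (p ∸_) (∣⁅x⁆∣≡1 𝟎))

  ∃-low-energy : ∃[ ξ ] m * energy ξ ≤ N * m + N * N
  ∃-low-energy
    with ξ , below-average ← ∃-below-average (∁ ⁅ 𝟎 ⁆) energy (subst (0 <_) (sym ∣nonzero∣≡m) (m<n⇒0<n∸m 1<p)) =
    ξ , subst (λ s → s * energy ξ ≤ N * s + N * N) ∣nonzero∣≡m (≤-trans below-average (∑-energy≤ (∁ ⁅ 𝟎 ⁆)))

  bound-at-low-energy : ∀ ξ → m * energy ξ ≤ N * m + N * N → N * m ≤ ∣ Z ∣ * (N + m)
  bound-at-low-energy ξ low with ratio? ξ
  ... | yes ratio  = bound-at-ratio ξ ratio low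
  ... | no  ¬ratio = bound-off-ratio ξ ¬ratio

  bound : N * m ≤ ∣ Z ∣ * (N + m)
  bound = uncurry bound-at-low-energy ∃-low-energy

corollary5 : (p : ℕ) (pr : Prime p) → 2 < p → (K k : ℕ) → 0 < K → 0 < k →
    (Y : Subset p) → 1 < ∣ Y ∣ →
    ∣ KYk-KYk p {{prime⇒nonZero pr}} K k Y ∣ * ∣ Y ∣ * (p ∸ 1)
      ≤ ∣ KYk-KYk p {{prime⇒nonZero pr}} (4 * K + 1) (suc k) Y ∣
        * (∣ KYk-KYk p {{prime⇒nonZero pr}} K k Y ∣ * ∣ Y ∣ + (p ∸ 1))
corollary5 p pr _ K zero    _ () Y 1<∣Y∣
corollary5 p pr _ K (suc k) _ _  Y 1<∣Y∣ = Bound.bound p pr K k Y 1<∣Y∣
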